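{- Let $G=(N,E)$ be a road network, $s,t\in N$, $k$ a positive integer and $\theta$ a similarity threshold. Let $P_{all}$ be the set of all $s$–$t$ paths in $G$, let $P_A\subseteq P_{all}$ be a set of $k$ paths that are pairwise sufficiently dissimilar (i.e., $Sim(p_i,p_j)<\theta$ for all distinct $p_i,p_j\in P_A$), and let $P^*_{k-1}$ be a set of $k-1$ shortest paths in $P_{all}$ (i.e., $k-1$ paths of $P_{all}$ such that no path of $P_{all}\setminus P^*_{k-1}$ is shorter than any path of $P^*_{k-1}$). If a path $p\in P_{all}\setminus P_A$ satisfies $\mathcal{L}(\{p\}\cup P^*_{k-1})>\mathcal{L}(P_A)$, then $p$ cannot be part of the kDPwML result for $(G,s,t,k,\theta)$, i.e., no set $P$ satisfying conditions (A), (B), (C) of the kDPwML problem contains $p$.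
   Context: A road network is a directed graph $G=(N,E)$ where each edge $(n_i,n_j)\in E$ has a positive weight $w(n_i,n_j)$. A path from $s$ to $t$ is a connected, cycle-free sequence of edges from $s$ to $t$. Its length is $\ell(p)=\sum_{(n_i,n_j)\in p} w(n_i,n_j)$, and for a set $P$ of paths $\mathcal{L}(P)=\sum_{p\in P}\ell(p)$. The similarity of two paths is the weighted Jaccard coefficient $Sim(p,p')=\frac{\sum_{e\in p\cap p'} w(e)}{\sum_{e\in p\cup p'} w(e)}$ (paths viewed as edge sets). The kDPwML problem for $(G,s,t,k,\theta)$ asks for a set $P$ of $s$–$t$ paths such that (A) $Sim(p_i,p_j)<\theta$ for all distinct $p_i,p_j\in P$; (B) $|P|\le k$ and $|P|$ is maximum among all sets of at most $k$ $s$–$t$ paths satisfying (A); (C) $\mathcal{L}(P)$ is minimum among all sets satisfying (A) and (B).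
   Formalization: The edge weights and the similarity threshold θ are rational. -}

module Defs where

open import Data.Nat using (ℕ; _∸_) renaming (_≤_ to _≤ℕ_)
open import Data.Fin using (Fin) renaming (_≟_ to _≟ᶠ_)
open import Data.Maybe using (Maybe; just; nothing; maybe)
open import Data.Product using (_×_; _,_; ∃)
open import Data.Product.Properties using (≡-dec)
open import Data.List using (List; []; _∷_; length; map; foldr; filter)
open import Data.List.Relation.Unary.All using (All)
open import Data.List.Relation.Unary.Unique.Propositional using (Unique)
open import Data.List.Membership.Propositional using (_∈_; _∉_)
import Data.List.Membership.DecPropositional as DecMem
import Data.List.Properties as LP
open import Data.Rational using (ℚ; 0ℚ; _+_; _÷_; _<_; _≤_; _≟_; ≢-nonZero)
open import Relation.Nullary using (Dec; yes; no; ¬_)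
open import Relation.Binary.PropositionalEquality using (_≡_; _≢_)
open import Relation.Binary.Definitions using (DecidableEquality)

record RoadNetwork : Set where
  field
    n        : ℕ
    w        : Fin n → Fin n → Maybe ℚ
    w-pos    : ∀ i j q → w i j ≡ just q → 0ℚ < q

open RoadNetwork public

module _ (G : RoadNetwork) where

  Node : Set
  Node = Fin (n G)

  Edge : Node → Node → Set
  Edge i j = ∃ λ q → w G i j ≡ just q

  data Walk : Node → Node → List Node → Set where
    stop : ∀ {s} → Walk s s (s ∷ [])
    step : ∀ {s u t xs} → Edge s u → Walk u t (u ∷ xs) → Walk s t (s ∷ u ∷ xs)

  STPath : Node → Node → List Node → Set
  STPath s t xs = Walk s t xs × Unique xs

  Path : Set
  Path = List Node

  _≟ᵖ_ : DecidableEquality Path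
  _≟ᵖ_ = LP.≡-dec _≟ᶠ_

  _≟ᵉ_ : DecidableEquality (Node × Node)
  _≟ᵉ_ = ≡-dec _≟ᶠ_ _≟ᶠ_

  edges : Path → List (Node × Node)
  edges (x ∷ y ∷ r) = (x , y) ∷ edges (y ∷ r)
  edges _ = []

  weight : Node × Node → ℚ
  weight (i , j) = maybe (λ q → q) 0ℚ (w G i j)

  sumℚ : List ℚ → ℚ
  sumℚ = foldr _+_ 0ℚ

  wsum : List (Node × Node) → ℚ
  wsum es = sumℚ (map weight es)

  len : Path → ℚ
  len p = wsum (edges p)

  totalLen : List Path → ℚ
  totalLen P = sumℚ (map len P)

  interW : Path → Path → ℚ
  interW p q = wsum (filter (λ e → DecMem._∈?_ _≟ᵉ_ e (edges q)) (edges p))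

  unionW : Path → Path → ℚ
  unionW p q = wsum (edges p) + wsum (filter (λ e → ¬? (DecMem._∈?_ _≟ᵉ_ e (edges p))) (edges q))
    where
    open import Relation.Nullary using (¬?)

  -- weighted Jaccard similarity (convention: 0 when the union has weight 0)
  Sim : Path → Path → ℚ
  Sim p q with unionW p q ≟ 0ℚ
  ... | yes _ = 0ℚ
  ... | no u≢0 = (interW p q ÷ unionW p q) {{≢-nonZero u≢0}}

  -- {p} ∪ P for a set P of paths represented as a duplicate-free list
  insertSet : Path → List Path → List Path
  insertSet p P with DecMem._∈?_ _≟ᵖ_ p P
  ... | yes _ = P
  ... | no _  = p ∷ P

  PathSet : Node → Node → List Path → Set
  PathSet s t P = Unique P × All (STPath s t) P

  Dissimilar : ℚ → List Path → Set
  Dissimilar θ P = ∀ {p q} → p ∈ P → q ∈ P → p ≢ q → Sim p q < θ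

  CondA : Node → Node → ℚ → List Path → Set
  CondA s t θ P = PathSet s t P × Dissimilar θ P

  CondB : Node → Node → ℕ → ℚ → List Path → Set
  CondB s t k θ P = length P ≤ℕ k × (∀ Q → CondA s t θ Q → length Q ≤ℕ k → length Q ≤ℕ length P)

  CondC : Node → Node → ℕ → ℚ → List Path → Set
  CondC s t k θ P = ∀ Q → CondA s t θ Q → CondB s t k θ Q → totalLen P ≤ totalLen Q

  KDPwML : Node → Node → ℕ → ℚ → List Path → Set
  KDPwML s t k θ P = CondA s t θ P × CondB s t k θ P × CondC s t k θ P

-- If p lay in a kDPwML result P, then |P| = k because PA already gives k
-- pairwise dissimilar paths, so P ∖ {p} is a set of k − 1 s–t paths; an
-- exchange argument shows it weighs at least L(Pk). Hence
-- L({p} ∪ Pk) ≤ ℓ(p) + L(Pk) ≤ L(P) ≤ L(PA), contradicting the hypothesis.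
module Submission where

open import Defs
open import Data.Nat using (ℕ; _∸_; suc; s≤s⁻¹) renaming (_≤_ to _≤ℕ_)
import Data.Nat.Properties as ℕ
open import Data.Empty using (⊥-elim)
open import Data.List using (List; []; _∷_; length; foldr; map)
open import Data.List.Properties using (length-removeAt; length-removeAt′)
open import Data.List.Membership.Propositional using (_∈_; _∉_; _─_; find)
import Data.List.Membership.DecPropositional as DecMembership
open import Data.List.Relation.Unary.Any using (here; there)
open import Data.List.Relation.Unary.All as All using (All; _∷_; all?)
open import Data.List.Relation.Unary.All.Properties using (─⁺; ¬All⇒Any¬)
open import Data.List.Relation.Unary.AllPairs using (_∷_)
open import Data.List.Relation.Unary.Unique.Propositional using (Unique)
open import Data.List.Relation.Binary.Subset.Propositional using (_⊆_)
open import Data.Maybe using (just; nothing)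
open import Data.Product using (_,_)
open import Data.Rational using (ℚ; 0ℚ; _+_; _<_; _≤_)
import Data.Rational.Properties as ℚ
open import Algebra.Bundles using (module CommutativeMonoid)
open import Algebra.Properties.CommutativeSemigroup (CommutativeMonoid.commutativeSemigroup ℚ.+-0-commutativeMonoid) using (x∙yz≈y∙xz)
open import Relation.Binary.Definitions using (DecidableEquality)
open import Relation.Binary.PropositionalEquality using (_≡_; _≢_; refl; sym; trans; cong; subst)
open import Relation.Nullary using (yes; no)

q≤p+q : ∀ {p q} → 0ℚ ≤ p → q ≤ p + q
q≤p+q {p} {q} 0≤p = subst (_≤ p + q) (ℚ.+-identityˡ q) (ℚ.+-monoˡ-≤ q 0≤p)

module _ {X : Set} where

  ∈-─⁻ : ∀ {x y} {xs : List X} (x∈xs : x ∈ xs) → y ∈ xs ─ x∈xs → y ∈ xs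
  ∈-─⁻ (here _)   y∈         = there y∈
  ∈-─⁻ (there _)  (here y≡)  = here y≡
  ∈-─⁻ (there x∈) (there y∈) = there (∈-─⁻ x∈ y∈)

  ∈-─ : ∀ {x y} {xs : List X} (x∈xs : x ∈ xs) → y ∈ xs → y ≢ x → y ∈ xs ─ x∈xs
  ∈-─ (here refl) (here refl) y≢x = ⊥-elim (y≢x refl)
  ∈-─ (here _)    (there y∈)  _   = y∈
  ∈-─ (there _)   (here y≡)   _   = here y≡
  ∈-─ (there x∈)  (there y∈)  y≢x = there (∈-─ x∈ y∈ y≢x)

  Unique-─ : ∀ {x} {xs : List X} → Unique xs → (x∈xs : x ∈ xs) → Unique (xs ─ x∈xs)
  Unique-─ (_ ∷ u)  (here _)   = u
  Unique-─ (y≢ ∷ u) (there x∈) = ─⁺ x∈ y≢ ∷ Unique-─ u x∈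

  Unique⇒∉-─ : ∀ {x} {xs : List X} → Unique xs → (x∈xs : x ∈ xs) → x ∉ xs ─ x∈xs
  Unique⇒∉-─ (x≢ ∷ _) (here refl) x∈ = All.lookup x≢ x∈ refl
  Unique⇒∉-─ (y≢ ∷ _) (there x∈)  (here refl) = All.lookup y≢ x∈ refl
  Unique⇒∉-─ (_  ∷ u) (there x∈)  (there x∈′) = Unique⇒∉-─ u x∈ x∈′

  length-─-≤ : ∀ {x n} {xs : List X} (x∈xs : x ∈ xs) → length xs ≤ℕ suc n → length (xs ─ x∈xs) ≤ℕ n
  length-─-≤ {xs = xs} x∈xs |xs|≤ = s≤s⁻¹ (subst (_≤ℕ _) (length-removeAt′ xs _) |xs|≤)

module WeightedSum {X : Set} (f : X → ℚ) (f≥0 : ∀ x → 0ℚ ≤ f x) where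

  ∑ : List X → ℚ
  ∑ xs = foldr _+_ 0ℚ (map f xs)

  ∑-nonneg : ∀ xs → 0ℚ ≤ ∑ xs
  ∑-nonneg []       = ℚ.≤-refl
  ∑-nonneg (x ∷ xs) = subst (_≤ f x + ∑ xs) (ℚ.+-identityʳ 0ℚ) (ℚ.+-mono-≤ (f≥0 x) (∑-nonneg xs))

  ∑-─ : ∀ {x} {xs : List X} (x∈xs : x ∈ xs) → ∑ xs ≡ f x + ∑ (xs ─ x∈xs)
  ∑-─ (here refl) = refl
  ∑-─ {x} {y ∷ xs} (there x∈) =
    trans (cong (f y +_) (∑-─ x∈)) (x∙yz≈y∙xz (f y) (f x) (∑ (xs ─ x∈)))

  ∑-mono-⊆ : ∀ {xs ys : List X} → Unique xs → xs ⊆ ys → ∑ xs ≤ ∑ ys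
  ∑-mono-⊆ {[]}     {ys} _          _     = ∑-nonneg ys
  ∑-mono-⊆ {x ∷ xs} {ys} (x≢ ∷ uxs) xs⊆ys =
    subst (∑ (x ∷ xs) ≤_) (sym (∑-─ x∈ys))
      (ℚ.+-monoʳ-≤ (f x) (∑-mono-⊆ uxs (λ y∈ → ∈-─ x∈ys (xs⊆ys (there y∈)) (λ y≡x → All.lookup x≢ y∈ (sym y≡x)))))
    where x∈ys = xs⊆ys (here refl)

  module _ (_≟_ : DecidableEquality X) where
    open DecMembership _≟_ using (_∈?_)

    -- Cancel common elements; pair each remaining element of A with one of Q
    -- that outweighs it; whatever is left of Q only adds non-negative weight.
    ∑-exchange : ∀ {A Q : List X} → Unique A → Unique Q → length A ≤ℕ length Q →
                 (∀ {a b} → a ∈ A → a ∉ Q → b ∈ Q → b ∉ A → f a ≤ f b) → ∑ A ≤ ∑ Q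
    ∑-exchange {[]}    {Q}     _  _ _  _ = ∑-nonneg Q
    ∑-exchange {_ ∷ _} {[]}    _  _ () _
    ∑-exchange {A}     {r ∷ Q} uA (r≢ ∷ uQ) |A|≤ A≤Q with r ∈? A
    ... | yes r∈A = subst (_≤ ∑ (r ∷ Q)) (sym (∑-─ r∈A)) (ℚ.+-monoʳ-≤ (f r) rest≤Q)
      where
      rest≤Q : ∑ (A ─ r∈A) ≤ ∑ Q
      rest≤Q = ∑-exchange (Unique-─ uA r∈A) uQ (length-─-≤ r∈A |A|≤)
        λ a∈ a∉Q b∈Q b∉ → A≤Q (∈-─⁻ r∈A a∈)
          (λ { (here refl) → Unique⇒∉-─ uA r∈A a∈ ; (there a∈Q) → a∉Q a∈Q })
          (there b∈Q) (λ b∈A → b∉ (∈-─ r∈A b∈A (λ { refl → All.lookup r≢ b∈Q refl })))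
    ... | no r∉A with all? (_∈? Q) A
    ...   | yes A⊆Q = ℚ.≤-trans (∑-mono-⊆ uA (All.lookup A⊆Q)) (q≤p+q (f≥0 r))
    ...   | no A⊈Q with find (¬All⇒Any¬ (_∈? Q) A A⊈Q)
    ...     | a , a∈A , a∉Q = subst (_≤ ∑ (r ∷ Q)) (sym (∑-─ a∈A)) (ℚ.+-mono-≤ a≤r rest≤Q)
      where
      ∉r∷Q : ∀ {a′} → a′ ∈ A → a′ ∉ Q → a′ ∉ r ∷ Q
      ∉r∷Q a′∈A _    (here refl)  = r∉A a′∈A
      ∉r∷Q _    a′∉Q (there a′∈Q) = a′∉Q a′∈Q

      a≤r : f a ≤ f r
      a≤r = A≤Q a∈A (∉r∷Q a∈A a∉Q) (here refl) r∉A

      rest≤Q : ∑ (A ─ a∈A) ≤ ∑ Q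
      rest≤Q = ∑-exchange (Unique-─ uA a∈A) uQ (length-─-≤ a∈A |A|≤)
        λ a′∈ a′∉Q b∈Q b∉ → A≤Q (∈-─⁻ a∈A a′∈) (∉r∷Q (∈-─⁻ a∈A a′∈) a′∉Q)
          (there b∈Q) (λ b∈A → b∉ (∈-─ a∈A b∈A (λ { refl → a∉Q b∈Q })))

module _ (G : RoadNetwork) where

  weight-nonneg : ∀ e → 0ℚ ≤ weight G e
  weight-nonneg (i , j) with w G i j in eq
  ... | nothing = ℚ.≤-refl
  ... | just q  = ℚ.<⇒≤ (w-pos G i j q eq)

  len-nonneg : ∀ p → 0ℚ ≤ len G p
  len-nonneg p = WeightedSum.∑-nonneg (weight G) weight-nonneg (edges G p)

  open WeightedSum (len G) len-nonneg using (∑-exchange)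

  totalLen-insertSet : ∀ p P → totalLen G (insertSet G p P) ≤ len G p + totalLen G P
  totalLen-insertSet p P with DecMembership._∈?_ (_≟ᵖ_ G) p P
  ... | yes _ = q≤p+q (len-nonneg p)
  ... | no _  = ℚ.≤-refl

  module _ {s t : Node G} where

    shortest-paths-minimal : ∀ {Pk Q} → Unique Pk → (∀ {q r} → q ∈ Pk → STPath G s t r → r ∉ Pk → len G q ≤ len G r) →
                             PathSet G s t Q → length Pk ≡ length Q → totalLen G Pk ≤ totalLen G Q
    shortest-paths-minimal uPk shortest (uQ , Q-paths) |Pk|≡|Q| =
      ∑-exchange (_≟ᵖ_ G) uPk uQ (ℕ.≤-reflexive |Pk|≡|Q|)
        λ q∈Pk _ r∈Q r∉Pk → shortest q∈Pk (All.lookup Q-paths r∈Q) r∉Pk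

    module _ {k : ℕ} {θ : ℚ} where

      length≡⇒CondB : ∀ P → length P ≡ k → CondB G s t k θ P
      length≡⇒CondB P |P|≡k = ℕ.≤-reflexive |P|≡k , λ Q _ |Q|≤k → subst (length Q ≤ℕ_) (sym |P|≡k) |Q|≤k

      KDPwML-length : ∀ {PA P} → CondA G s t θ PA → length PA ≡ k → KDPwML G s t k θ P → length P ≡ k
      KDPwML-length {PA} PA-A |PA|≡k (_ , (|P|≤k , maximal) , _) =
        ℕ.≤-antisym |P|≤k (subst (_≤ℕ _) |PA|≡k (maximal PA PA-A (ℕ.≤-reflexive |PA|≡k)))

lemma4p1 : (G : RoadNetwork) (s t : Node G) (k : ℕ) (θ : ℚ) → 1 ≤ℕ k →
    (PA : List (Path G)) → PathSet G s t PA → length PA ≡ k → Dissimilar G θ PA →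
    (Pk : List (Path G)) → PathSet G s t Pk → length Pk ≡ k ∸ 1 →
    (∀ {q r} → q ∈ Pk → STPath G s t r → r ∉ Pk → len G q ≤ len G r) →
    (p : Path G) → STPath G s t p → p ∉ PA →
    totalLen G PA < totalLen G (insertSet G p Pk) →
    (P : List (Path G)) → KDPwML G s t k θ P → p ∉ P
lemma4p1 G s t k θ _ PA PA-paths |PA|≡k PA-dissimilar Pk (Pk-unique , _) |Pk|≡k∸1 Pk-shortest
  p _ _ PA<p∪Pk P P-result@(((P-unique , P-paths) , _) , _ , P-minimal) p∈P =
  ℚ.<-irrefl refl (begin-strict
    totalLen G PA                    <⟨ PA<p∪Pk ⟩
    totalLen G (insertSet G p Pk)    ≤⟨ totalLen-insertSet G p Pk ⟩
    len G p + totalLen G Pk          ≤⟨ ℚ.+-monoʳ-≤ (len G p) Pk≤P∖p ⟩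
    len G p + totalLen G (P ─ p∈P)   ≡⟨ sym (∑-─ p∈P) ⟩
    totalLen G P                     ≤⟨ P-minimal PA PA-A (length≡⇒CondB G PA |PA|≡k) ⟩
    totalLen G PA                    ∎)
  where
  open ℚ.≤-Reasoning
  open WeightedSum (len G) (len-nonneg G) using (∑-─)

  PA-A : CondA G s t θ PA
  PA-A = PA-paths , PA-dissimilar

  |Pk|≡|P∖p| : length Pk ≡ length (P ─ p∈P)
  |Pk|≡|P∖p| = trans |Pk|≡k∸1 (trans (cong (_∸ 1) (sym (KDPwML-length G PA-A |PA|≡k P-result)))
                                     (sym (length-removeAt P _)))

  Pk≤P∖p : totalLen G Pk ≤ totalLen G (P ─ p∈P)
  Pk≤P∖p = shortest-paths-minimal G Pk-unique Pk-shortest (Unique-─ P-unique p∈P , ─⁺ p∈P P-paths) |Pk|≡|P∖p|
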